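{- For every sequence $(t_\iota)_{\iota<\alpha}$ of total (possibly infinite) terms, $\liminf_{\iota\to\alpha} t_\iota = \lim_{\iota\to\alpha} t_\iota$ whenever $\lim_{\iota\to\alpha} t_\iota$ is defined or $\liminf_{\iota\to\alpha} t_\iota$ is a total term.
   Context: Partial terms are terms over $\Sigma_\bot=\Sigma\uplus\{\bot\}$, ordered by $s\le_\bot t$ iff $s$ is obtained from $t$ by replacing some subterm occurrences by $\bot$ (a complete semilattice); total terms contain no $\bot$. The limit inferior is $\liminf_{\iota\to\alpha} t_\iota=\bigsqcup_{\beta<\alpha}\mathrm{glb}\{t_\iota\mid \beta\le\iota<\alpha\}$, where $\mathrm{glb}$ is the greatest lower bound w.r.t.\ $\le_\bot$. The limit $\lim$ is taken in the complete ultrametric space of total terms with $d(s,t)=2^{ -k}$, $k$ the minimal depth at which $s$ and $t$ differ ($d(t,t)=0$). -}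

module Defs where

open import Data.Nat using (ℕ; _<_)
open import Data.List using (List; []; _∷ʳ_; length)
open import Data.Maybe using (Maybe; just; nothing)
open import Data.Product using (Σ; ∃; _×_; _,_)
open import Data.Sum using (_⊎_)
open import Relation.Nullary using (¬_)
open import Relation.Binary.PropositionalEquality using (_≡_; _≢_)
open import Relation.Binary.Structures using (IsStrictTotalOrder)
open import Induction.WellFounded using (WellFounded)

ExcludedMiddle : Set₁
ExcludedMiddle = (P : Set) → P ⊎ ¬ P

record Signature : Set₁ where
  field
    Sym   : Set
    arity : Sym → ℕ

data Sym⊥ (Sg : Signature) : Set where
  bot : Sym⊥ Sg
  sym : Signature.Sym Sg → Sym⊥ Sg

arity⊥ : (Sg : Signature) → Sym⊥ Sg → ℕ
arity⊥ Sg bot     = 0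
arity⊥ Sg (sym f) = Signature.arity Sg f

-- Positions: finite sequences of child indices, read from the root.
Pos : Set
Pos = List ℕ

-- A (possibly infinite) partial term over Σ_⊥: a labelling of a
-- non-empty, prefix-closed tree domain of positions, respecting arities
-- (position p ∷ʳ i exists iff p exists with a symbol of arity > i).
record Term (Sg : Signature) : Set where
  field
    lab    : Pos → Maybe (Sym⊥ Sg)
    root   : ∃ λ f → lab [] ≡ just f
    child  : ∀ p i → (∃ λ f → lab p ≡ just f × i < arity⊥ Sg f)
                   → ∃ λ g → lab (p ∷ʳ i) ≡ just g
    parent : ∀ p i g → lab (p ∷ʳ i) ≡ just g
                   → ∃ λ f → lab p ≡ just f × i < arity⊥ Sg f
open Term public

module _ {Sg : Signature} where

  Total : Term Sg → Set
  Total t = ∀ p → lab t p ≢ just bot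

  -- s ≤⊥ t : s is obtained from t by replacing some subterm occurrences
  -- by ⊥, i.e. s and t coincide on all non-⊥ positions of s.
  _≤⊥_ : Term Sg → Term Sg → Set
  s ≤⊥ t = ∀ p f → lab s p ≡ just (sym f) → lab t p ≡ just (sym f)

  _≈ₜ_ : Term Sg → Term Sg → Set
  s ≈ₜ t = ∀ p → lab s p ≡ lab t p

  -- s and t agree on all positions of depth < k,  i.e. d(s,t) ≤ 2^{-k}
  AgreeBelow : ℕ → Term Sg → Term Sg → Set
  AgreeBelow k s t = ∀ p → length p < k → lab s p ≡ lab t p

-- An ordinal α, given as a well-ordered set (its elements are the ι < α).
record Ordinal : Set₁ where
  field
    Idx          : Set
    _≺_          : Idx → Idx → Set
    isStrictTotalOrder : IsStrictTotalOrder _≡_ _≺_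
    wellFounded  : WellFounded _≺_

  _≼_ : Idx → Idx → Set
  i ≼ j = i ≺ j ⊎ i ≡ j

module _ {Sg : Signature} (α : Ordinal) (t : Ordinal.Idx α → Term Sg) where
  open Ordinal α

  IsGlbFrom : Idx → Term Sg → Set
  IsGlbFrom β g =
    (∀ ι → β ≼ ι → g ≤⊥ t ι) ×
    (∀ u → (∀ ι → β ≼ ι → u ≤⊥ t ι) → u ≤⊥ g)

  IsLiminf : Term Sg → Set
  IsLiminf s =
    (∀ β g → IsGlbFrom β g → g ≤⊥ s) ×
    (∀ u → (∀ β g → IsGlbFrom β g → g ≤⊥ u) → s ≤⊥ u)

  IsLimit : Term Sg → Set
  IsLimit s = Total s ×
    (∀ k → ∃ λ β → ∀ ι → β ≼ ι → AgreeBelow k (t ι) s)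

module Submission where

-- The argument works in classical logic (the ExcludedMiddle hypothesis) and
-- needs three facts about the partial order ≤⊥ on partial terms:
--   * every non-empty family of terms has a greatest lower bound, which
--     carries the common label of the family wherever the family agrees
--     along the whole path from the root;
--   * ≤⊥ is antisymmetric when the upper term is total;
--   * any symbol of a term can be cut off, i.e. replaced by ⊥.
-- If l is a limit, the glbs of late tails contain every finite part of l,
-- so l ≤⊥ s; and every glb is ≤⊥ l, so s ≤⊥ l; by antisymmetry s = l.
-- If s is total, cutting s at a symbol position p shows (by contradiction)
-- that the t_ι eventually carry s's label at p; since arities are finite,
-- an induction on depth turns this into eventual agreement with s below
-- every depth k, i.e. s is the limit.

open import Defs
open import Data.Product using (∃; ∃₂; _×_; _,_; proj₁; proj₂)
open import Data.Sum using (_⊎_; inj₁; inj₂; [_,_]′)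
open import Data.Nat using (ℕ; zero; suc; _<_; z≤n; s≤s; _<?_)
open import Data.Nat.Properties
  using (n<1+n; m<m+n; m<n⇒m<1+n; m<1+n⇒m<n∨m≡n; <-irrefl; ≤-pred)
open import Data.List using ([]; _∷_; _++_; _∷ʳ_; length; [_]; _∷ʳ′_; initLast)
open import Data.List.Properties using (++-assoc; ++-identityʳ; length-++; ∷-injective)
open import Data.Maybe using (Maybe; just; nothing)
open import Data.Maybe.Properties using (just-injective)
open import Data.Empty using (⊥; ⊥-elim)
open import Relation.Nullary using (¬_; yes; no)
open import Relation.Binary.PropositionalEquality
  using (_≡_; _≢_; refl; trans; cong; subst) renaming (sym to ≡-sym)
open import Relation.Binary.Structures using (IsStrictTotalOrder)
open import Relation.Binary.Definitions using (tri<; tri≈; tri>)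

infix 4 _⊏_
_⊏_ : Pos → Pos → Set
q ⊏ p = ∃₂ λ (i : ℕ) (r : Pos) → p ≡ q ++ (i ∷ r)

⊏-[] : ∀ {q} → ¬ (q ⊏ [])
⊏-[] {[]} (_ , _ , ())
⊏-[] {_ ∷ _} (_ , _ , ())

⊏-∷ʳ : ∀ p j {q} → q ⊏ p ∷ʳ j → q ≡ p ⊎ q ⊏ p
⊏-∷ʳ [] j {[]} _ = inj₁ refl
⊏-∷ʳ [] j {_ ∷ q} (i , r , e) = ⊥-elim (⊏-[] (i , r , proj₂ (∷-injective e)))
⊏-∷ʳ (x ∷ p) j {[]} _ = inj₂ (x , p , refl)
⊏-∷ʳ (x ∷ p) j {y ∷ q} (i , r , e) with ∷-injective e
... | refl , e′ with ⊏-∷ʳ p j (i , r , e′)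
... | inj₁ refl = inj₁ refl
... | inj₂ (i′ , r′ , refl) = inj₂ (i′ , r′ , refl)

⊏-extend : ∀ {q p} i → q ⊏ p → q ⊏ p ∷ʳ i
⊏-extend {q} i (j , r , refl) = j , r ∷ʳ i , ++-assoc q (j ∷ r) [ i ]

⊏-length : ∀ {q p} → q ⊏ p → length q < length p
⊏-length {q} (i , r , refl) =
  subst (length q <_) (≡-sym (length-++ q)) (m<m+n (length q) (s≤s z≤n))

⊏-irrefl : ∀ {q} → ¬ (q ⊏ q)
⊏-irrefl q⊏q = <-irrefl refl (⊏-length q⊏q)

module TermFacts {Sg : Signature} where

  ⊥-no-children : ∀ {c} i → just bot ≡ just c → ¬ (i < arity⊥ Sg c)
  ⊥-no-children i refl ()

  defined-prefix : (u : Term Sg) → ∀ q r {c} → lab u (q ++ r) ≡ just c → ∃ λ c′ → lab u q ≡ just c′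
  defined-prefix u q [] {c} e = c , trans (cong (lab u) (≡-sym (++-identityʳ q))) e
  defined-prefix u q (i ∷ r) e
    with defined-prefix u (q ∷ʳ i) r (trans (cong (lab u) (++-assoc q [ i ] r)) e)
  ... | c′ , e′ = let (f , ef , _) = parent u q i c′ e′ in f , ef

  symbol-above : (u : Term Sg) → ∀ {q p c} → q ⊏ p → lab u p ≡ just c → ∃ λ f → lab u q ≡ just (sym f)
  symbol-above u {q} (i , r , refl) e
    with defined-prefix u (q ∷ʳ i) r (trans (cong (lab u) (++-assoc q [ i ] r)) e)
  ... | c′ , e′ with parent u q i c′ e′
  ... | bot , _ , ()
  ... | sym f , ef , _ = f , ef

  symbol-at-prefix : (u : Term Sg) → ∀ p r {f} → lab u (p ++ r) ≡ just (sym f) → ∃ λ g → lab u p ≡ just (sym g)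
  symbol-at-prefix u p [] {f} e = f , trans (cong (lab u) (≡-sym (++-identityʳ p))) e
  symbol-at-prefix u p (i ∷ r) e = symbol-above u (i , r , refl) e

  beyond-arity : (u : Term Sg) → ∀ p i {c} r → lab u p ≡ just c → ¬ (i < arity⊥ Sg c) → lab u ((p ∷ʳ i) ++ r) ≡ nothing
  beyond-arity u p i r e i≮ with lab u ((p ∷ʳ i) ++ r) in e′
  ... | nothing = refl
  ... | just d with defined-prefix u (p ∷ʳ i) r e′
  ... | c′ , e″ with parent u p i c′ e″
  ... | _ , ec , i< = ⊥-elim (i≮ (subst (λ c → i < arity⊥ Sg c) (just-injective (trans (≡-sym ec) e)) i<))

  total-above-defined : ∀ {a b : Term Sg} → Total b → a ≤⊥ b → ∀ p {c} → lab a p ≡ just c → ∃ λ d → lab b p ≡ just d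
  total-above-defined {a} {b} _ a≤b p e with initLast p
  ... | [] = root b
  ... | q ∷ʳ′ i with parent a q i _ e
  ... | bot , ec , ()
  ... | sym g , ec , i< = child b q i (sym g , a≤b q g ec , i<)

  ≤⊥-antisym : ∀ {a b : Term Sg} → Total b → a ≤⊥ b → b ≤⊥ a → a ≈ₜ b
  ≤⊥-antisym {a} {b} b-total a≤b b≤a p with lab a p in ea | lab b p in eb
  ... | just (sym f) | _ = trans (≡-sym (a≤b p f ea)) eb
  ... | nothing | nothing = refl
  ... | nothing | just bot = ⊥-elim (b-total p eb)
  ... | nothing | just (sym f) with trans (≡-sym ea) (b≤a p f eb)
  ...   | ()
  ≤⊥-antisym {a} {b} b-total a≤b b≤a p | just bot | _
    with total-above-defined {a} {b} b-total a≤b p ea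
  ... | bot , ed = ⊥-elim (b-total p ed)
  ... | sym f , ed with trans (≡-sym ea) (b≤a p f ed)
  ...   | ()

open TermFacts

IsGlb : {Sg : Signature} {I : Set} → (I → Term Sg) → Term Sg → Set
IsGlb u g = (∀ i → g ≤⊥ u i) × (∀ v → (∀ i → v ≤⊥ u i) → v ≤⊥ g)

-- Every non-empty family u (with a chosen member u i₀) has a glb G: at p,
-- G carries the common label of the family if the family agrees at p and
-- all strict prefixes of p; it carries ⊥ if the family agrees strictly
-- above p but not at p (and p exists); otherwise p is outside G.
module GlbConstruction (em : ExcludedMiddle) {Sg : Signature} {I : Set} (u : I → Term Sg) (i₀ : I) where

  AgreeAt : Pos → Set
  AgreeAt q = ∃ λ m → ∀ i → lab (u i) q ≡ m

  AgreeAbove : Pos → Set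
  AgreeAbove p = ∀ q → q ⊏ p → AgreeAt q

  DefinedAt : Pos → Set
  DefinedAt q = ∃ λ d → lab (u i₀) q ≡ just d

  choose : ∀ {A B C : Set} → A ⊎ ¬ A → B ⊎ ¬ B → C ⊎ ¬ C → (B → Maybe (Sym⊥ Sg)) → Maybe (Sym⊥ Sg)
  choose (inj₁ _) (inj₁ b) _ common = common b
  choose (inj₁ _) (inj₂ _) (inj₁ _) _ = just bot
  choose (inj₁ _) (inj₂ _) (inj₂ _) _ = nothing
  choose (inj₂ _) _ _ _ = nothing

  glbLab : Pos → Maybe (Sym⊥ Sg)
  glbLab p = choose (em (AgreeAbove p)) (em (AgreeAt p)) (em (DefinedAt p)) proj₁

  glb-agrees : ∀ p → AgreeAbove p → AgreeAt p → glbLab p ≡ lab (u i₀) p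
  glb-agrees p above at with em (AgreeAbove p) | em (AgreeAt p) | em (DefinedAt p)
  ... | inj₁ _ | inj₁ (m , h) | _ = ≡-sym (h i₀)
  ... | inj₁ _ | inj₂ ¬at | _ = ⊥-elim (¬at at)
  ... | inj₂ ¬above | _ | _ = ⊥-elim (¬above above)

  glb-defined : ∀ p → AgreeAbove p → DefinedAt p → ∃ λ g → glbLab p ≡ just g
  glb-defined p above (d , e) with em (AgreeAbove p) | em (AgreeAt p) | em (DefinedAt p)
  ... | inj₁ _ | inj₁ (m , h) | _ = d , trans (≡-sym (h i₀)) e
  ... | inj₁ _ | inj₂ _ | inj₁ _ = bot , refl
  ... | inj₁ _ | inj₂ _ | inj₂ ¬def = ⊥-elim (¬def (d , e))
  ... | inj₂ ¬above | _ | _ = ⊥-elim (¬above above)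

  above-∷ʳ : ∀ p i → AgreeAbove p → AgreeAt p → AgreeAbove (p ∷ʳ i)
  above-∷ʳ p i above at q q⊏ with ⊏-∷ʳ p i q⊏
  ... | inj₁ refl = at
  ... | inj₂ q⊏p = above q q⊏p

  above-init : ∀ p i → AgreeAbove (p ∷ʳ i) → AgreeAbove p × AgreeAt p
  above-init p i above = (λ q q⊏p → above q (⊏-extend i q⊏p)) , above p (i , [] , refl)

  glb-child : ∀ p i c → glbLab p ≡ just c → i < arity⊥ Sg c → ∃ λ g → glbLab (p ∷ʳ i) ≡ just g
  glb-child p i c e i< with em (AgreeAbove p) | em (AgreeAt p) | em (DefinedAt p)
  ... | inj₁ above | inj₁ (m , h) | _ =
    glb-defined (p ∷ʳ i) (above-∷ʳ p i above (m , h)) (child (u i₀) p i (c , trans (h i₀) e , i<))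
  ... | inj₁ _ | inj₂ _ | inj₁ _ = ⊥-elim (⊥-no-children i e i<)
  glb-child p i c () i< | inj₁ _ | inj₂ _ | inj₂ _
  glb-child p i c () i< | inj₂ _ | _ | _

  glb-parent : ∀ p i g → glbLab (p ∷ʳ i) ≡ just g → ∃ λ f → glbLab p ≡ just f × i < arity⊥ Sg f
  glb-parent p i g e with em (AgreeAbove (p ∷ʳ i)) | em (AgreeAt (p ∷ʳ i)) | em (DefinedAt (p ∷ʳ i))
  ... | inj₁ above | inj₁ (m , h) | _ = from-u₀ above (parent (u i₀) p i g (trans (h i₀) e))
    where
    from-u₀ : AgreeAbove (p ∷ʳ i) → ∃ (λ f → lab (u i₀) p ≡ just f × i < arity⊥ Sg f) →
              ∃ λ f → glbLab p ≡ just f × i < arity⊥ Sg f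
    from-u₀ above (f , ef , i<) =
      let (above′ , at) = above-init p i above in f , trans (glb-agrees p above′ at) ef , i<
  ... | inj₁ above | inj₂ _ | inj₁ (d , ed) with parent (u i₀) p i d ed
  ...   | f , ef , i< = let (above′ , at) = above-init p i above in f , trans (glb-agrees p above′ at) ef , i<
  glb-parent p i g () | inj₁ _ | inj₂ _ | inj₂ _
  glb-parent p i g () | inj₂ _ | _ | _

  G : Term Sg
  lab G = glbLab
  root G = glb-defined [] (λ q q⊏[] → ⊥-elim (⊏-[] q⊏[])) (root (u i₀))
  child G p i (c , e , i<) = glb-child p i c e i<
  parent G = glb-parent

  G-lower : ∀ i → G ≤⊥ u i
  G-lower i p f e with em (AgreeAbove p) | em (AgreeAt p) | em (DefinedAt p)
  ... | inj₁ _ | inj₁ (m , h) | _ = trans (h i) e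
  G-lower i p f () | inj₁ _ | inj₂ _ | inj₁ _
  G-lower i p f () | inj₁ _ | inj₂ _ | inj₂ _
  G-lower i p f () | inj₂ _ | _ | _

  -- A lower bound v agrees with the family along the path to each of its
  -- symbols (all of which lie on symbols of v), so it lies below G.
  G-greatest : ∀ v → (∀ i → v ≤⊥ u i) → v ≤⊥ G
  G-greatest v v≤ p f e = trans (glb-agrees p above at) (v≤ i₀ p f e)
    where
    above : AgreeAbove p
    above q q⊏p = let (h , eh) = symbol-above v q⊏p e in just (sym h) , λ i → v≤ i q h eh
    at : AgreeAt p
    at = just (sym f) , λ i → v≤ i p f e

  G-glb : IsGlb u G
  G-glb = G-lower , G-greatest

-- Cutting s at a position p: the term s[⊥]_p, equal to s except that the
-- subterm at p is replaced by ⊥.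
module Cut (em : ExcludedMiddle) {Sg : Signature} (s : Term Sg) (p : Pos) {c : Sym⊥ Sg} (sp : lab s p ≡ just c) where

  Below : Pos → Set
  Below q = ∃ λ r → q ≡ p ++ r

  cut : ∀ {A : Pos → Set} → (∃ λ r → A r) ⊎ ¬ (∃ λ r → A r) → Maybe (Sym⊥ Sg) → Maybe (Sym⊥ Sg)
  cut (inj₁ ([] , _)) _ = just bot
  cut (inj₁ (_ ∷ _ , _)) _ = nothing
  cut (inj₂ _) m = m

  cutLab : Pos → Maybe (Sym⊥ Sg)
  cutLab q = cut (em (Below q)) (lab s q)

  cut-root : ∃ λ c′ → cutLab [] ≡ just c′
  cut-root with em (Below [])
  ... | inj₁ ([] , _) = bot , refl
  ... | inj₁ (i ∷ r , e) = ⊥-elim (⊏-[] (i , r , e))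
  ... | inj₂ _ = root s

  cut-child : ∀ q i c′ → cutLab q ≡ just c′ → i < arity⊥ Sg c′ → ∃ λ g → cutLab (q ∷ʳ i) ≡ just g
  cut-child q i c′ e i< with em (Below q)
  ... | inj₁ ([] , _) = ⊥-elim (⊥-no-children i e i<)
  cut-child q i c′ () i< | inj₁ (_ ∷ _ , _)
  ... | inj₂ q∉ with em (Below (q ∷ʳ i))
  ... | inj₁ ([] , _) = bot , refl
  ... | inj₁ (j ∷ r , e′) with ⊏-∷ʳ q i (j , r , e′)
  ...   | inj₁ refl = ⊥-elim (q∉ ([] , ≡-sym (++-identityʳ q)))
  ...   | inj₂ (j′ , r′ , e″) = ⊥-elim (q∉ (j′ ∷ r′ , e″))
  cut-child q i c′ e i< | inj₂ q∉ | inj₂ _ = child s q i (c′ , e , i<)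

  cut-parent : ∀ q i g → cutLab (q ∷ʳ i) ≡ just g → ∃ λ c′ → cutLab q ≡ just c′ × i < arity⊥ Sg c′
  cut-parent q i g e with em (Below (q ∷ʳ i))
  cut-parent q i g () | inj₁ (_ ∷ _ , _)
  ... | inj₁ ([] , e₁) with em (Below q)
  ...   | inj₁ (r , e₂) = ⊥-elim (⊏-irrefl (i , r , q-below-itself))
    where
    q-below-itself : q ≡ q ++ (i ∷ r)
    q-below-itself = trans e₂ (trans (cong (_++ r) (≡-sym (trans e₁ (++-identityʳ p)))) (++-assoc q [ i ] r))
  ...   | inj₂ _ = parent s q i c (trans (cong (lab s) (trans e₁ (++-identityʳ p))) sp)
  cut-parent q i g e | inj₂ qi∉ with em (Below q)
  ... | inj₁ (r , e₂) = ⊥-elim (qi∉ (r ∷ʳ i , trans (cong (_∷ʳ i) e₂) (++-assoc p r [ i ])))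
  ... | inj₂ _ = parent s q i g e

  U : Term Sg
  lab U = cutLab
  root U = cut-root
  child U q i (c′ , e , i<) = cut-child q i c′ e i<
  parent U = cut-parent

  cut-at : ∀ f → lab U p ≢ just (sym f)
  cut-at f e with em (Below p)
  cut-at f () | inj₁ ([] , _)
  ... | inj₁ (i ∷ r , e′) = ⊏-irrefl (i , r , e′)
  ... | inj₂ p∉ = p∉ ([] , ≡-sym (++-identityʳ p))

  cut-outside : ∀ q → ¬ Below q → lab U q ≡ lab s q
  cut-outside q q∉ with em (Below q)
  ... | inj₁ below = ⊥-elim (q∉ below)
  ... | inj₂ _ = refl

-- Elementary facts on the order ≼ of an ordinal: it is a total preorder, so
-- finitely many eventual properties hold eventually simultaneously.
module OrdinalFacts (α : Ordinal) where
  open Ordinal α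
  open IsStrictTotalOrder isStrictTotalOrder renaming (trans to ≺-trans)

  ≼-refl : ∀ {a} → a ≼ a
  ≼-refl = inj₂ refl

  ≼-trans : ∀ {a b c} → a ≼ b → b ≼ c → a ≼ c
  ≼-trans (inj₁ a≺b) (inj₁ b≺c) = inj₁ (≺-trans a≺b b≺c)
  ≼-trans (inj₁ a≺b) (inj₂ refl) = inj₁ a≺b
  ≼-trans (inj₂ refl) b≼c = b≼c

  upper-bound : ∀ a b → ∃ λ c → a ≼ c × b ≼ c
  upper-bound a b with compare a b
  ... | tri< a≺b _ _ = b , inj₁ a≺b , ≼-refl
  ... | tri≈ _ a≡b _ = b , inj₂ a≡b , ≼-refl
  ... | tri> _ _ b≺a = a , ≼-refl , inj₁ b≺a

  eventually-all : (Q : ℕ → Idx → Set) → (∀ {i a b} → Q i a → a ≼ b → Q i b) → ∀ β₀ n →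
                   (∀ i → i < n → ∃ (Q i)) → ∃ λ β → β₀ ≼ β × (∀ i → i < n → Q i β)
  eventually-all Q up β₀ zero _ = β₀ , ≼-refl , λ i ()
  eventually-all Q up β₀ (suc n) each
    with eventually-all Q up β₀ n (λ i i<n → each i (m<n⇒m<1+n i<n)) | each n (n<1+n n)
  ... | β₁ , β₀≼β₁ , first | βₙ , last with upper-bound β₁ βₙ
  ... | β , β₁≼β , βₙ≼β = β , ≼-trans β₀≼β₁ β₁≼β , all
    where
    all : ∀ i → i < suc n → Q i β
    all i i< with m<1+n⇒m<n∨m≡n i<
    ... | inj₁ i<n = up (first i i<n) β₁≼β
    ... | inj₂ refl = up last βₙ≼β

limit-respects-≈ : {Sg : Signature} (α : Ordinal) (t : Ordinal.Idx α → Term Sg) →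
                   ∀ {s l} → s ≈ₜ l → IsLimit α t l → IsLimit α t s
limit-respects-≈ α t s≈l (l-total , converges) =
  (λ p e → l-total p (trans (≡-sym (s≈l p)) e)) ,
  λ k → let (β , agree) = converges k in
        β , λ ι β≼ι p p< → trans (agree ι β≼ι p p<) (≡-sym (s≈l p))

module Liminf (em : ExcludedMiddle) {Sg : Signature} (α : Ordinal)
              (t : Ordinal.Idx α → Term Sg) (s : Term Sg) (liminf : IsLiminf α t s) where
  open Ordinal α
  open OrdinalFacts α

  glb-above-liminf : ∀ β g → IsGlbFrom α t β g → g ≤⊥ s
  glb-above-liminf = proj₁ liminf

  liminf-least : ∀ u → (∀ β g → IsGlbFrom α t β g → g ≤⊥ u) → s ≤⊥ u
  liminf-least = proj₂ liminf

  module Tail (β : Idx) = GlbConstruction em {I = ∃ (β ≼_)} (λ ι → t (proj₁ ι)) (β , ≼-refl)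

  tail-glb : ∀ β → IsGlbFrom α t β (Tail.G β)
  tail-glb β = let (lower , greatest) = Tail.G-glb β in
    (λ ι β≼ι → lower (ι , β≼ι)) , (λ v v≤ → greatest v (λ ι → v≤ (proj₁ ι) (proj₂ ι)))

  -- A limit l is below s: late tails agree with l down to the depth of p,
  -- so their glb carries l's label at p.
  limit≤liminf : ∀ l → IsLimit α t l → l ≤⊥ s
  limit≤liminf l (_ , converges) p f e with converges (suc (length p))
  ... | β , agree = glb-above-liminf β (Tail.G β) (tail-glb β) p f
                      (trans (Tail.glb-agrees β p above (agree-at p (n<1+n _)))
                             (trans (agree β ≼-refl p (n<1+n _)) e))
    where
    agree-at : ∀ q → length q < suc (length p) → Tail.AgreeAt β q
    agree-at q q< = lab l q , λ ι → agree (proj₁ ι) (proj₂ ι) q q<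
    above : Tail.AgreeAbove β p
    above q q⊏p = agree-at q (m<n⇒m<1+n (⊏-length q⊏p))

  -- Every tail glb is below a limit l, hence so is their lub s.
  liminf≤limit : ∀ l → IsLimit α t l → s ≤⊥ l
  liminf≤limit l (_ , converges) = liminf-least l glb≤l
    where
    glb≤l : ∀ β g → IsGlbFrom α t β g → g ≤⊥ l
    glb≤l β g (g-lower , _) p f e with converges (suc (length p))
    ... | β′ , agree with upper-bound β β′
    ... | ι , β≼ι , β′≼ι = trans (≡-sym (agree ι β′≼ι p (n<1+n _))) (g-lower ι β≼ι p f e)

  liminf≈limit : ∀ l → IsLimit α t l → s ≈ₜ l
  liminf≈limit l l-limit = ≤⊥-antisym {a = s} {l} (proj₁ l-limit) (liminf≤limit l l-limit) (limit≤liminf l l-limit)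

  -- At a symbol position p of s the t_ι eventually carry s's label: otherwise
  -- no tail glb has a symbol at or below p, so all of them lie below the cut
  -- s[⊥]_p, and then so does s, which is absurd.
  eventually-symbol : ∀ p f → lab s p ≡ just (sym f) → ∃ λ β → ∀ ι → β ≼ ι → lab (t ι) p ≡ lab s p
  eventually-symbol p f sp with em (∃ λ β → ∀ ι → β ≼ ι → lab (t ι) p ≡ lab s p)
  ... | inj₁ stable = stable
  ... | inj₂ unstable = ⊥-elim (cut-at f (liminf-least U glb≤U p f sp))
    where
    open Cut em s p sp
    glb≤U : ∀ β g → IsGlbFrom α t β g → g ≤⊥ U
    glb≤U β g g-glb q h e = [ inside , outside ]′ (em (Below q))
      where
      outside : ¬ Below q → lab U q ≡ just (sym h)
      outside q∉ = trans (cut-outside q q∉) (glb-above-liminf β g g-glb q h e)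
      inside : Below q → lab U q ≡ just (sym h)
      inside (r , refl) =
        let (h′ , eh′) = symbol-at-prefix g p r e in
        ⊥-elim (unstable (β , λ ι β≼ι →
          trans (proj₁ g-glb ι β≼ι p h′ eh′) (≡-sym (glb-above-liminf β g g-glb p h′ eh′))))

  StableFrom : Idx → Pos → ℕ → Set
  StableFrom β p k = ∀ ι → β ≼ ι → ∀ r → length r < k → lab (t ι) (p ++ r) ≡ lab s (p ++ r)

  stable-up : ∀ {p k β β′} → StableFrom β p k → β ≼ β′ → StableFrom β′ p k
  stable-up stable β≼β′ ι β′≼ι = stable ι (≼-trans β≼β′ β′≼ι)

  -- For total s, induction on k: stabilise at p itself, then in each of the
  -- finitely many argument positions; positions beyond the arity of p are
  -- absent both in s and in the t_ι that carry s's symbol at p.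
  eventually-stable : Total s → ∀ k p f → lab s p ≡ just (sym f) → ∃ λ β → StableFrom β p k
  eventually-stable s-total zero p f sp = proj₁ (eventually-symbol p f sp) , λ ι _ r ()
  eventually-stable s-total (suc k) p f sp
    with eventually-symbol p f sp
  ... | β₀ , at-p
    with eventually-all (λ i β → StableFrom β (p ∷ʳ i) k) (λ {i} → stable-up {p ∷ʳ i} {k})
                        β₀ (Signature.arity Sg f) arguments
    where
    arguments : ∀ i → i < Signature.arity Sg f → ∃ λ β → StableFrom β (p ∷ʳ i) k
    arguments i i< with child s p i (sym f , sp , i<)
    ... | bot , e = ⊥-elim (s-total _ e)
    ... | sym g , e = eventually-stable s-total k (p ∷ʳ i) g e
  ... | β , β₀≼β , in-arguments = β , stable
    where
    stable : StableFrom β p (suc k)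
    stable ι β≼ι [] _ rewrite ++-identityʳ p = at-p ι (≼-trans β₀≼β β≼ι)
    stable ι β≼ι (i ∷ r) r< rewrite ≡-sym (++-assoc p [ i ] r) with i <? Signature.arity Sg f
    ... | yes i< = in-arguments i i< ι β≼ι r (≤-pred r<)
    ... | no i≮ = trans (beyond-arity (t ι) p i r (trans (at-p ι (≼-trans β₀≼β β≼ι)) sp) i≮)
                        (≡-sym (beyond-arity s p i r sp i≮))

  total-liminf-is-limit : Total s → IsLimit α t s
  total-liminf-is-limit s-total = s-total , converges
    where
    converges : ∀ k → ∃ λ β → ∀ ι → β ≼ ι → AgreeBelow k (t ι) s
    converges k with root s
    ... | bot , e = ⊥-elim (s-total [] e)
    ... | sym f , e = eventually-stable s-total k [] f e

proposition4p8 : ExcludedMiddle → (Sg : Signature) (α : Ordinal)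
    (t : Ordinal.Idx α → Term Sg) → (∀ ι → Total (t ι)) →
    (s : Term Sg) → IsLiminf α t s →
    ((∃ λ l → IsLimit α t l) ⊎ Total s) →
    IsLimit α t s × (∀ l → IsLimit α t l → s ≈ₜ l)
proposition4p8 em Sg α t _ s liminf (inj₁ (l , l-limit)) =
  limit-respects-≈ α t {s} {l} (liminf≈limit l l-limit) l-limit , liminf≈limit
  where open Liminf em α t s liminf
proposition4p8 em Sg α t _ s liminf (inj₂ s-total) =
  total-liminf-is-limit s-total , liminf≈limit
  where open Liminf em α t s liminf
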